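{- Let $\alpha$ be a composition of $n$ and let $m_i$ be the number of parts of $\alpha$ equal to $i$ ($1\le i\le k$, where $k$ is the largest part). Then $$\Phi_\alpha=\binom{\ell(\alpha)}{m_1,m_2,\dots,m_k}^{ -1}\sum_{\beta\succcurlyeq\alpha}|\mathrm{OSP}(\alpha,\beta)|\,M_\beta.$$
   Context: A composition of $n$ is a sequence of positive integers summing to $n$; $\ell(\alpha)$ is its number of parts. $\alpha\preccurlyeq\beta$ ($\beta\succcurlyeq\alpha$) means $\beta$ is obtained from $\alpha$ by summing consecutive blocks of parts; $\alpha^{(i)}$ is the block of parts of $\alpha$ summing to $\beta_i$. $M_\beta=\sum_{i_1<\cdots<i_r}x_{i_1}^{\beta_1}\cdots x_{i_r}^{\beta_r}$. $z_\alpha=\prod_i i^{m_i}m_i!$. For a composition $\gamma$, $\mathrm{sp}(\gamma)=\ell(\gamma)!\prod_j\gamma_j$, and for $\alpha\preccurlyeq\beta$, $\mathrm{sp}(\alpha,\beta)=\prod_{i}\mathrm{sp}(\alpha^{(i)})$. The type 2 quasisymmetric power sum is $\Phi_\alpha=z_\alpha\sum_{\beta\succcurlyeq\alpha}\frac{1}{\mathrm{sp}(\alpha,\beta)}M_\beta$. For $\alpha\preccurlyeq\beta$, $\mathrm{OSP}(\alpha,\beta)$ is the set of ordered set partitions $(B_1,\dots,B_{\ell(\beta)})$ of $\{1,\dots,\ell(\alpha)\}$ with $|B_i|=\ell(\alpha^{(i)})$; $\mathrm{OSP}(\alpha,\beta)=\emptyset$ if $\alpha\not\preccurlyeq\beta$.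 -}

module Defs where

open import Data.Nat as ℕ using (ℕ; zero; suc; _⊔_; _!; _≟_)
open import Data.Nat.Combinatorics using (_C_)
open import Data.Integer using (+_)
open import Data.Rational using (ℚ; 0ℚ; 1ℚ; _/_; _+_; _*_)
open import Data.List using (List; []; _∷_; [_]; length; map; foldr; concatMap; filter; upTo; applyUpTo)
open import Data.List.Properties using (≡-dec)
open import Relation.Nullary.Decidable using (⌊_⌋)
open import Data.Bool using (if_then_else_)

sumℕ : List ℕ → ℕ
sumℕ = foldr ℕ._+_ 0

prodℕ : List ℕ → ℕ
prodℕ = foldr ℕ._*_ 1

maxℕ : List ℕ → ℕ
maxℕ = foldr _⊔_ 0

count : ℕ → List ℕ → ℕ
count i []       = 0
count i (a ∷ as) = if ⌊ i ≟ a ⌋ then suc (count i as) else count i as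

ℕtoℚ : ℕ → ℚ
ℕtoℚ n = + n / 1

-- 1/d for d ≥ 1 (only ever applied to nonzero naturals below; inv 0 = 0)
inv : ℕ → ℚ
inv zero    = 0ℚ
inv (suc k) = + 1 / suc k

sumℚ : List ℚ → ℚ
sumℚ = foldr _+_ 0ℚ

powℚ : ℚ → ℕ → ℚ
powℚ x zero    = 1ℚ
powℚ x (suc k) = x * powℚ x k

-- Compositions are lists of positive naturals.
-- Coarsenings β ≽ α are encoded by the splittings of α into nonempty
-- consecutive blocks α^(1),…,α^(r); then β = map sumℕ blocks.
-- (For compositions with positive parts this is a bijection.)

extendSplit : {A : Set} → A → List (List A) → List (List (List A))
extendSplit a []       = [ [ a ] ∷ [] ]
extendSplit a (b ∷ bs) = ([ a ] ∷ b ∷ bs) ∷ ((a ∷ b) ∷ bs) ∷ []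

splittings : {A : Set} → List A → List (List (List A))
splittings []       = [ [] ]
splittings (a ∷ as) = concatMap (extendSplit a) (splittings as)

coarse : List (List ℕ) → List ℕ
coarse = map sumℕ

-- Monomial quasisymmetric function M_β evaluated at finitely many
-- variables x_1,…,x_N (the list x):  sum over i_1<…<i_r of
-- x_{i_1}^{β_1} ⋯ x_{i_r}^{β_r}.

M : List ℕ → List ℚ → ℚ
M []       xs       = 1ℚ
M (b ∷ β)  []       = 0ℚ
M (b ∷ β)  (x ∷ xs) = powℚ x b * M β xs + M (b ∷ β) xs

mult : List ℕ → ℕ → ℕ
mult α i = count i α

mults : List ℕ → List ℕ
mults α = applyUpTo (λ j → mult α (suc j)) (maxℕ α)

z : List ℕ → ℕ
z α = prodℕ (applyUpTo (λ j → (suc j) ℕ.^ (mult α (suc j)) ℕ.* (mult α (suc j)) !) (maxℕ α))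

sp : List ℕ → ℕ
sp γ = (length γ) ! ℕ.* prodℕ γ

spRel : List (List ℕ) → ℕ
spRel blocks = prodℕ (map sp blocks)

Φ : List ℕ → List ℚ → ℚ
Φ α x = ℕtoℚ (z α) * sumℚ (map (λ bl → inv (spRel bl) * M (coarse bl) x) (splittings α))

multinomial : List ℕ → ℕ
multinomial []       = 1
multinomial (m ∷ ms) = ((m ℕ.+ sumℕ ms) C m) ℕ.* multinomial ms

-- Ordered set partitions (B_1,…,B_r) of {1,…,ℓ} with |B_i| = s_i.
-- Encoded by the word w ∈ {0,…,r-1}^ℓ with w_p = (index of the block
-- containing p) - 1; the block sizes are then the letter counts.

words : ℕ → ℕ → List (List ℕ)
words zero    r = [ [] ]
words (suc ℓ) r = concatMap (λ w → map (λ j → j ∷ w) (upTo r)) (words ℓ r)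

blockSizes : ℕ → List ℕ → List ℕ
blockSizes r w = map (λ j → count j w) (upTo r)

OSPsizes : ℕ → List ℕ → List (List ℕ)
OSPsizes ℓ s = filter (λ w → ≡-dec _≟_ (blockSizes (length s) w) s) (words ℓ (length s))

OSP : List ℕ → List (List ℕ) → List (List ℕ)
OSP α blocks = OSPsizes (length α) (map length blocks)

{-# OPTIONS --safe #-}
-- Both coefficients of M_β are governed by L = ℓ(α)! ∏ α.  On the one hand z_α = ∏ i^{m_i} m_i!,
-- with ∏ i^{m_i} = ∏ α and Σ m_i = ℓ(α), so z_α · (ℓ(α) choose m_1,…,m_k) = L.  On the other hand
-- sp(α,β) = ∏ ℓ(α^(i))! · ∏ α, and the ordered set partitions with block sizes s_1,…,s_r are the
-- words of length ℓ(α) with letter counts s, of which there are ℓ(α)! / ∏ s_i! (induction on the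
-- length, splitting by the first letter); so sp(α,β) · |OSP(α,β)| = L as well, and the two
-- expansions agree term by term.
module Submission where

open import Defs
open import Algebra.Bundles using (CommutativeMonoid)
open import Data.List using (List; []; _∷_; map; length; concat; foldr; applyUpTo)
open import Data.List.Relation.Unary.All as All using (All; []; _∷_)
open import Data.Nat using (ℕ; zero; suc; _<_; s≤s; z<s; s<s)
open import Data.Nat.Properties using (suc-injective)
open import Function using (_∘_)
open import Relation.Binary.PropositionalEquality

nth : List ℕ → ℕ → ℕ
nth []      _       = 0
nth (a ∷ s) zero    = a
nth (a ∷ s) (suc i) = nth s i

module RangeFold {c ℓ} (M : CommutativeMonoid c ℓ) where

  open CommutativeMonoid M renaming (refl to ≈-refl; sym to ≈-sym; trans to ≈-trans)
  open import Algebra.Properties.CommutativeSemigroup commutativeSemigroup using (interchange; x∙yz≈y∙xz)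

  fold< : ℕ → (ℕ → Carrier) → Carrier
  fold< r h = foldr _∙_ ε (applyUpTo h r)

  fold<-cong : ∀ r {h g} → (∀ {i} → i < r → h i ≈ g i) → fold< r h ≈ fold< r g
  fold<-cong zero    h≈g = ≈-refl
  fold<-cong (suc r) h≈g = ∙-cong (h≈g z<s) (fold<-cong r (h≈g ∘ s<s))

  fold<-ε : ∀ r → fold< r (λ _ → ε) ≈ ε
  fold<-ε zero    = ≈-refl
  fold<-ε (suc r) = ≈-trans (identityˡ _) (fold<-ε r)

  fold<-distrib : ∀ r h g → fold< r (λ i → h i ∙ g i) ≈ fold< r h ∙ fold< r g
  fold<-distrib zero    h g = ≈-sym (identityˡ ε)
  fold<-distrib (suc r) h g =
    ≈-trans (∙-congˡ (fold<-distrib r (h ∘ suc) (g ∘ suc))) (interchange _ _ _ _)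

  fold<-update : ∀ {r j} h g a → j < r → (∀ {i} → i ≢ j → h i ≈ g i) → h j ≈ a ∙ g j →
                 fold< r h ≈ a ∙ fold< r g
  fold<-update {suc r} {zero}  h g a _ h≈g hj =
    ≈-trans (∙-cong hj (fold<-cong r (λ _ → h≈g λ ()))) (assoc _ _ _)
  fold<-update {suc r} {suc j} h g a (s≤s j<r) h≈g hj =
    ≈-trans (∙-cong (h≈g λ ()) (fold<-update (h ∘ suc) (g ∘ suc) a j<r (h≈g ∘ (_∘ suc-injective)) hj))
            (x∙yz≈y∙xz _ _ _)

  fold<-single : ∀ {r j} h → j < r → (∀ {i} → i ≢ j → h i ≈ ε) → fold< r h ≈ h j
  fold<-single {r} h j<r h≈ε =
    ≈-trans (fold<-update h (λ _ → ε) _ j<r h≈ε (≈-sym (identityʳ _)))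
            (≈-trans (∙-congˡ (fold<-ε r)) (identityʳ _))

  fold<-nth : ∀ (g : ℕ → Carrier) s → fold< (length s) (g ∘ nth s) ≈ foldr _∙_ ε (map g s)
  fold<-nth g []      = ≈-refl
  fold<-nth g (a ∷ s) = ∙-congˡ (fold<-nth g s)

module MultinomialIdentities where

  open import Data.Bool using (if_then_else_)
  open import Data.List using (upTo; concatMap; filter; _++_)
  open import Data.List.Properties
    using (map-++; map-∘; map-upTo; map-applyUpTo; map-cong; map-id; length-++; ∷-injective)
  open import Data.Nat using (_+_; _*_; _^_; _∸_; _≤_; _!; _≟_)
  open import Data.Nat.Combinatorics using (_C_; nCk≡n!/k![n-k]!; k![n∸k]!∣n!)
  open import Data.Nat.DivMod using (m/n*n≡m)
  open import Data.Nat.ListAction.Properties using (sum-++; product-++)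
  open import Data.Nat.Properties
  open import Algebra.Properties.CommutativeSemigroup *-commutativeSemigroup using (xy∙z≈xz∙y)
  open import Data.Product using (_,_)
  open import Function using (id)
  open import Relation.Nullary using (¬_; Dec; yes; no; contradiction)
  open import Relation.Nullary.Decidable using (⌊_⌋)
  open import Relation.Unary using (Pred; Decidable)
  open ≡-Reasoning

  open RangeFold +-0-commutativeMonoid using () renaming
    (fold< to ∑<; fold<-cong to ∑<-cong; fold<-ε to ∑<-0; fold<-distrib to ∑<-distrib-+;
     fold<-update to ∑<-update; fold<-single to ∑<-single; fold<-nth to ∑<-nth)
  open RangeFold *-1-commutativeMonoid using () renaming
    (fold< to ∏<; fold<-cong to ∏<-cong; fold<-ε to ∏<-1; fold<-distrib to ∏<-distrib-*;
     fold<-update to ∏<-update; fold<-single to ∏<-single; fold<-nth to ∏<-nth)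

  *-distribʳ-∑< : ∀ r h c → ∑< r h * c ≡ ∑< r (λ i → h i * c)
  *-distribʳ-∑< zero    h c = refl
  *-distribʳ-∑< (suc r) h c = trans (*-distribʳ-+ c (h 0) _) (cong (h 0 * c +_) (*-distribʳ-∑< r (h ∘ suc) c))

  ∑<≡0⇒≡0 : ∀ {r h i} → ∑< r h ≡ 0 → i < r → h i ≡ 0
  ∑<≡0⇒≡0 {suc r} {h} {zero}  ∑≡0 _         = m+n≡0⇒m≡0 (h 0) ∑≡0
  ∑<≡0⇒≡0 {suc r} {h} {suc i} ∑≡0 (s≤s i<r) =
    ∑<≡0⇒≡0 {r} {h ∘ suc} (m+n≡0⇒n≡0 (h 0) ∑≡0) i<r

  ∏<≡0 : ∀ {r j} h → j < r → h j ≡ 0 → ∏< r h ≡ 0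
  ∏<≡0 h j<r hj≡0 = ∏<-update h h 0 j<r (λ _ → refl) hj≡0

  sum-map-≡0 : ∀ {a} {A : Set a} {g : A → ℕ} → (∀ x → g x ≡ 0) → ∀ xs → sumℕ (map g xs) ≡ 0
  sum-map-≡0 g≡0 []       = refl
  sum-map-≡0 g≡0 (x ∷ xs) = cong₂ _+_ (g≡0 x) (sum-map-≡0 g≡0 xs)

  δ : ℕ → ℕ → ℕ
  δ a b = if ⌊ a ≟ b ⌋ then 1 else 0

  δ-refl : ∀ a → δ a a ≡ 1
  δ-refl a with a ≟ a
  ... | yes _   = refl
  ... | no a≢a = contradiction refl a≢a

  δ-≢ : ∀ {a b} → a ≢ b → δ a b ≡ 0
  δ-≢ {a} {b} a≢b with a ≟ b
  ... | yes a≡b = contradiction a≡b a≢b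
  ... | no _    = refl

  δ-suc : ∀ a b → δ (suc a) (suc b) ≡ δ a b
  δ-suc a b with a ≟ b
  ... | yes refl = δ-refl (suc a)
  ... | no a≢b   = δ-≢ (a≢b ∘ suc-injective)

  count-∷ : ∀ i a w → count i (a ∷ w) ≡ δ i a + count i w
  count-∷ i a w with i ≟ a
  ... | yes _ = refl
  ... | no _  = refl

  count-∷-self : ∀ a w → count a (a ∷ w) ≡ suc (count a w)
  count-∷-self a w = trans (count-∷ a a w) (cong (_+ count a w) (δ-refl a))

  count-∷-other : ∀ {i a} w → i ≢ a → count i (a ∷ w) ≡ count i w
  count-∷-other {i} {a} w i≢a = trans (count-∷ i a w) (cong (_+ count i w) (δ-≢ i≢a))

  countsIndicator : ℕ → (ℕ → ℕ) → List ℕ → ℕ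
  countsIndicator r f w = ∏< r (λ i → δ (count i w) (f i))

  #wordsWithCounts : ℕ → ℕ → (ℕ → ℕ) → ℕ
  #wordsWithCounts ℓ r f = sumℕ (map (countsIndicator r f) (words ℓ r))

  decrementAt : ℕ → (ℕ → ℕ) → ℕ → ℕ
  decrementAt j f i = f i ∸ δ i j

  decrementAt-self : ∀ {k} f j → f j ≡ suc k → decrementAt j f j ≡ k
  decrementAt-self f j fj≡1+k = cong₂ _∸_ fj≡1+k (δ-refl j)

  decrementAt-other : ∀ {i j} f → i ≢ j → decrementAt j f i ≡ f i
  decrementAt-other f i≢j = cong (f _ ∸_) (δ-≢ i≢j)

  ∑<-decrementAt : ∀ {r j k} f → j < r → f j ≡ suc k → ∑< r f ≡ suc (∑< r (decrementAt j f))
  ∑<-decrementAt {j = j} f j<r fj≡1+k =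
    ∑<-update f (decrementAt j f) 1 j<r (sym ∘ decrementAt-other f)
      (trans fj≡1+k (cong suc (sym (decrementAt-self f j fj≡1+k))))

  ∏!-decrementAt : ∀ {r j k} f → j < r → f j ≡ suc k →
                   ∏< r (λ i → f i !) ≡ suc k * ∏< r (λ i → decrementAt j f i !)
  ∏!-decrementAt {j = j} {k} f j<r fj≡1+k =
    ∏<-update _ _ (suc k) j<r (cong _! ∘ sym ∘ decrementAt-other f)
      (trans (cong _! fj≡1+k) (cong (λ n → suc k * n !) (sym (decrementAt-self f j fj≡1+k))))

  countsIndicator-∷-zero : ∀ {r j} f w → j < r → f j ≡ 0 → countsIndicator r f (j ∷ w) ≡ 0
  countsIndicator-∷-zero {j = j} f w j<r fj≡0 =
    ∏<≡0 (λ i → δ (count i (j ∷ w)) (f i)) j<r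
      (trans (cong₂ δ (count-∷-self j w) fj≡0) (δ-≢ {suc (count j w)} {0} λ ()))

  countsIndicator-∷-suc : ∀ {r k} f j w → f j ≡ suc k →
                          countsIndicator r f (j ∷ w) ≡ countsIndicator r (decrementAt j f) w
  countsIndicator-∷-suc {r} {k} f j w fj≡1+k = ∏<-cong r (λ {i} _ → factor i (i ≟ j))
    where
    factor : ∀ i → Dec (i ≡ j) → δ (count i (j ∷ w)) (f i) ≡ δ (count i w) (decrementAt j f i)
    factor i (yes refl) = begin
      δ (count i (i ∷ w)) (f i)         ≡⟨ cong₂ δ (count-∷-self i w) fj≡1+k ⟩
      δ (suc (count i w)) (suc k)       ≡⟨ δ-suc (count i w) k ⟩
      δ (count i w) k                   ≡⟨ cong (δ (count i w)) (decrementAt-self f i fj≡1+k) ⟨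
      δ (count i w) (decrementAt i f i) ∎
    factor i (no i≢j) = cong₂ δ (count-∷-other w i≢j) (sym (decrementAt-other f i≢j))

  countsIndicator-[] : ∀ {r f} → ∑< r f ≡ 0 → countsIndicator r f [] ≡ 1
  countsIndicator-[] {r} {f} ∑f≡0 =
    trans (∏<-cong r (λ i<r → trans (cong (δ 0) (∑<≡0⇒≡0 {r} {f} ∑f≡0 i<r)) (δ-refl 0))) (∏<-1 r)

  ∏!≡1 : ∀ {r f} → ∑< r f ≡ 0 → ∏< r (λ i → f i !) ≡ 1
  ∏!≡1 {r} {f} ∑f≡0 = trans (∏<-cong r (λ i<r → cong _! (∑<≡0⇒≡0 {r} {f} ∑f≡0 i<r))) (∏<-1 r)

  sum-words-suc : ∀ ℓ r (g : List ℕ → ℕ) →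
                  sumℕ (map g (words (suc ℓ) r)) ≡ ∑< r (λ j → sumℕ (map (λ w → g (j ∷ w)) (words ℓ r)))
  sum-words-suc ℓ r g = prepend (words ℓ r)
    where
    prependAll : List ℕ → List (List ℕ)
    prependAll w = map (_∷ w) (upTo r)
    prepend : ∀ W → sumℕ (map g (concatMap prependAll W)) ≡ ∑< r (λ j → sumℕ (map (λ w → g (j ∷ w)) W))
    prepend []      = sym (∑<-0 r)
    prepend (w ∷ W) = begin
      sumℕ (map g (prependAll w ++ concatMap prependAll W))
        ≡⟨ cong sumℕ (map-++ g (prependAll w) (concatMap prependAll W)) ⟩
      sumℕ (map g (prependAll w) ++ map g (concatMap prependAll W))
        ≡⟨ sum-++ (map g (prependAll w)) _ ⟩
      sumℕ (map g (prependAll w)) + sumℕ (map g (concatMap prependAll W))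
        ≡⟨ cong₂ _+_ (cong sumℕ (trans (sym (map-∘ (upTo r))) (map-upTo _ r))) (prepend W) ⟩
      ∑< r (λ j → g (j ∷ w)) + ∑< r (λ j → sumℕ (map (λ v → g (j ∷ v)) W))
        ≡⟨ ∑<-distrib-+ r _ _ ⟨
      ∑< r (λ j → g (j ∷ w) + sumℕ (map (λ v → g (j ∷ v)) W)) ∎

  ∏!-*-#wordsWithCounts : ∀ ℓ r f → ∑< r f ≡ ℓ →
                          ∏< r (λ i → f i !) * #wordsWithCounts ℓ r f ≡ ℓ !
  ∏!-*-#wordsWithCounts zero r f ∑f≡0 =
    cong₂ _*_ (∏!≡1 {r} {f} ∑f≡0) (trans (+-identityʳ _) (countsIndicator-[] {r} {f} ∑f≡0))
  ∏!-*-#wordsWithCounts (suc ℓ) r f ∑f≡1+ℓ = begin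
    F f * #wordsWithCounts (suc ℓ) r f    ≡⟨ cong (F f *_) (sum-words-suc ℓ r (countsIndicator r f)) ⟩
    F f * ∑< r #startingWith              ≡⟨ *-comm (F f) _ ⟩
    ∑< r #startingWith * F f              ≡⟨ *-distribʳ-∑< r #startingWith (F f) ⟩
    ∑< r (λ j → #startingWith j * F f)    ≡⟨ ∑<-cong r #startingWith-*-∏! ⟩
    ∑< r (λ j → f j * ℓ !)                ≡⟨ *-distribʳ-∑< r f (ℓ !) ⟨
    ∑< r f * ℓ !                          ≡⟨ cong (_* ℓ !) ∑f≡1+ℓ ⟩
    suc ℓ ! ∎
    where
    F : (ℕ → ℕ) → ℕ
    F g = ∏< r (λ i → g i !)
    #startingWith : ℕ → ℕ
    #startingWith j = sumℕ (map (λ w → countsIndicator r f (j ∷ w)) (words ℓ r))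
    #startingWith-*-∏! : ∀ {j} → j < r → #startingWith j * F f ≡ f j * ℓ !
    #startingWith-*-∏! {j} j<r with f j in fj
    ... | zero  = cong (_* F f) (sum-map-≡0 (λ w → countsIndicator-∷-zero f w j<r fj) (words ℓ r))
    ... | suc k = begin
      #startingWith j * F f                  ≡⟨ cong₂ _*_ #startingWith≡ (∏!-decrementAt f j<r fj) ⟩
      #wordsWithCounts ℓ r g * (suc k * F g) ≡⟨ *-comm (#wordsWithCounts ℓ r g) (suc k * F g) ⟩
      suc k * F g * #wordsWithCounts ℓ r g   ≡⟨ *-assoc (suc k) (F g) (#wordsWithCounts ℓ r g) ⟩
      suc k * (F g * #wordsWithCounts ℓ r g) ≡⟨ cong (suc k *_) (∏!-*-#wordsWithCounts ℓ r g ∑g≡ℓ) ⟩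
      suc k * ℓ ! ∎
      where
      g : ℕ → ℕ
      g = decrementAt j f
      #startingWith≡ : #startingWith j ≡ #wordsWithCounts ℓ r g
      #startingWith≡ = cong sumℕ (map-cong (λ w → countsIndicator-∷-suc {r} f j w fj) (words ℓ r))
      ∑g≡ℓ : ∑< r g ≡ ℓ
      ∑g≡ℓ = suc-injective (trans (sym (∑<-decrementAt f j<r fj)) ∑f≡1+ℓ)

  length-filter≡sum : ∀ {a p} {A : Set a} {P : Pred A p} (P? : Decidable P) (χ : A → ℕ) →
                      (∀ {x} → P x → χ x ≡ 1) → (∀ {x} → ¬ P x → χ x ≡ 0) →
                      ∀ xs → length (filter P? xs) ≡ sumℕ (map χ xs)
  length-filter≡sum P? χ P⇒1 ¬P⇒0 []       = refl
  length-filter≡sum P? χ P⇒1 ¬P⇒0 (x ∷ xs) with P? x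
  ... | yes px  = cong₂ _+_ (sym (P⇒1 px)) (length-filter≡sum P? χ P⇒1 ¬P⇒0 xs)
  ... | no ¬px = trans (length-filter≡sum P? χ P⇒1 ¬P⇒0 xs) (cong (_+ sumℕ (map χ xs)) (sym (¬P⇒0 ¬px)))

  ∏<δ≡1 : ∀ s g → applyUpTo g (length s) ≡ s → ∏< (length s) (λ i → δ (g i) (nth s i)) ≡ 1
  ∏<δ≡1 []      g _  = refl
  ∏<δ≡1 (a ∷ s) g eq with ∷-injective eq
  ... | g0≡a , rest = cong₂ _*_ (trans (cong (λ b → δ b a) g0≡a) (δ-refl a)) (∏<δ≡1 s (g ∘ suc) rest)

  ∏<δ≡0 : ∀ s g → applyUpTo g (length s) ≢ s → ∏< (length s) (λ i → δ (g i) (nth s i)) ≡ 0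
  ∏<δ≡0 []      g ne = contradiction refl ne
  ∏<δ≡0 (a ∷ s) g ne = byHead (g 0 ≟ a)
    where
    byHead : Dec (g 0 ≡ a) → δ (g 0) a * ∏< (length s) (λ i → δ (g (suc i)) (nth s i)) ≡ 0
    byHead (yes g0≡a) =
      cong₂ _*_ (trans (cong (λ b → δ b a) g0≡a) (δ-refl a)) (∏<δ≡0 s (g ∘ suc) (ne ∘ cong₂ _∷_ g0≡a))
    byHead (no g0≢a)  = cong (_* _) (δ-≢ g0≢a)

  length-OSPsizes : ∀ ℓ s → length (OSPsizes ℓ s) ≡ #wordsWithCounts ℓ (length s) (nth s)
  length-OSPsizes ℓ s = length-filter≡sum _ (countsIndicator (length s) (nth s))
    (λ {w} eq → ∏<δ≡1 s (λ i → count i w) (trans (sym (map-upTo _ (length s))) eq))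
    (λ {w} ne → ∏<δ≡0 s (λ i → count i w) (ne ∘ trans (map-upTo _ (length s))))
    (words ℓ (length s))

  ∏!-*-#OSPsizes : ∀ ℓ s → sumℕ s ≡ ℓ → prodℕ (map _! s) * length (OSPsizes ℓ s) ≡ ℓ !
  ∏!-*-#OSPsizes ℓ s ∑s≡ℓ = begin
    prodℕ (map _! s) * length (OSPsizes ℓ s)
      ≡⟨ cong₂ _*_ (sym (∏<-nth _! s)) (length-OSPsizes ℓ s) ⟩
    ∏< (length s) (λ i → nth s i !) * #wordsWithCounts ℓ (length s) (nth s)
      ≡⟨ ∏!-*-#wordsWithCounts ℓ (length s) (nth s) ∑nth≡ℓ ⟩
    ℓ ! ∎
    where
    ∑nth≡ℓ : ∑< (length s) (nth s) ≡ ℓ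
    ∑nth≡ℓ = trans (∑<-nth id s) (trans (cong sumℕ (map-id s)) ∑s≡ℓ)

  sum-map-length : ∀ {a} {A : Set a} (xss : List (List A)) → sumℕ (map length xss) ≡ length (concat xss)
  sum-map-length []         = refl
  sum-map-length (xs ∷ xss) = trans (cong (length xs +_) (sum-map-length xss)) (sym (length-++ xs))

  spRel≡∏!*∏ : ∀ bl → spRel bl ≡ prodℕ (map _! (map length bl)) * prodℕ (concat bl)
  spRel≡∏!*∏ []       = refl
  spRel≡∏!*∏ (b ∷ bl) = begin
    (length b ! * prodℕ b) * spRel bl                ≡⟨ cong (sp b *_) (spRel≡∏!*∏ bl) ⟩
    (length b ! * prodℕ b) * (P * prodℕ (concat bl)) ≡⟨ [m*n]*[o*p]≡[m*o]*[n*p] (length b !) (prodℕ b) P _ ⟩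
    (length b ! * P) * (prodℕ b * prodℕ (concat bl)) ≡⟨ cong (length b ! * P *_) (product-++ b (concat bl)) ⟨
    (length b ! * P) * prodℕ (b ++ concat bl)        ∎
    where
    P : ℕ
    P = prodℕ (map _! (map length bl))

  spRel-*-#OSP : ∀ α bl → concat bl ≡ α → spRel bl * length (OSP α bl) ≡ length α ! * prodℕ α
  spRel-*-#OSP .(concat bl) bl refl = begin
    spRel bl * N                             ≡⟨ cong (_* N) (spRel≡∏!*∏ bl) ⟩
    P * prodℕ (concat bl) * N                ≡⟨ xy∙z≈xz∙y P _ N ⟩
    P * N * prodℕ (concat bl)                ≡⟨ cong (_* prodℕ (concat bl)) P*N≡ℓ! ⟩
    length (concat bl) ! * prodℕ (concat bl) ∎
    where
    P N : ℕ
    P = prodℕ (map _! (map length bl))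
    N = length (OSP (concat bl) bl)
    P*N≡ℓ! : P * N ≡ length (concat bl) !
    P*N≡ℓ! = ∏!-*-#OSPsizes _ (map length bl) (sum-map-length bl)

  nCk*[k!*[n∸k]!]≡n! : ∀ {n k} → k ≤ n → (n C k) * (k ! * (n ∸ k) !) ≡ n !
  nCk*[k!*[n∸k]!]≡n! {n} {k} k≤n =
    trans (cong (_* (k ! * (n ∸ k) !)) (nCk≡n!/k![n-k]! k≤n))
          (m/n*n≡m {{k !* (n ∸ k) !≢0}} (k![n∸k]!∣n! k≤n))

  m!*[m+n]Cm*n!≡[m+n]! : ∀ m n → m ! * ((m + n) C m) * n ! ≡ (m + n) !
  m!*[m+n]Cm*n!≡[m+n]! m n = begin
    m ! * ((m + n) C m) * n !             ≡⟨ cong (_* n !) (*-comm (m !) ((m + n) C m)) ⟩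
    ((m + n) C m) * m ! * n !             ≡⟨ *-assoc ((m + n) C m) (m !) (n !) ⟩
    ((m + n) C m) * (m ! * n !)           ≡⟨ cong (λ k → ((m + n) C m) * (m ! * k !)) (m+n∸m≡n m n) ⟨
    ((m + n) C m) * (m ! * (m + n ∸ m) !) ≡⟨ nCk*[k!*[n∸k]!]≡n! (m≤m+n m n) ⟩
    (m + n) ! ∎

  ∏!-*-multinomial : ∀ ms → prodℕ (map _! ms) * multinomial ms ≡ sumℕ ms !
  ∏!-*-multinomial []       = refl
  ∏!-*-multinomial (m ∷ ms) = begin
    m ! * P * (((m + S) C m) * multinomial ms) ≡⟨ [m*n]*[o*p]≡[m*o]*[n*p] (m !) P _ _ ⟩
    m ! * ((m + S) C m) * (P * multinomial ms) ≡⟨ cong (m ! * ((m + S) C m) *_) (∏!-*-multinomial ms) ⟩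
    m ! * ((m + S) C m) * S !                  ≡⟨ m!*[m+n]Cm*n!≡[m+n]! m S ⟩
    (m + S) ! ∎
    where
    P S : ℕ
    P = prodℕ (map _! ms)
    S = sumℕ ms

  All-≤-maxℕ : ∀ α → All (_≤ maxℕ α) α
  All-≤-maxℕ []      = []
  All-≤-maxℕ (a ∷ α) =
    m≤m⊔n a (maxℕ α) ∷ All.map (λ p≤max → ≤-trans p≤max (m≤n⊔m a (maxℕ α))) (All-≤-maxℕ α)

  ∑<-count≡length : ∀ K α → All (1 ≤_) α → All (_≤ K) α →
                    ∑< K (λ j → count (suc j) α) ≡ length α
  ∑<-count≡length K []          _         _               = ∑<-0 K
  ∑<-count≡length K (suc a ∷ α) (_ ∷ pos) (a<K ∷ bounded) = begin
    ∑< K (λ j → count (suc j) (suc a ∷ α))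
      ≡⟨ ∑<-cong K (λ _ → count-∷ _ (suc a) α) ⟩
    ∑< K (λ j → δ (suc j) (suc a) + count (suc j) α)
      ≡⟨ ∑<-distrib-+ K _ _ ⟩
    ∑< K (λ j → δ (suc j) (suc a)) + ∑< K (λ j → count (suc j) α)
      ≡⟨ cong₂ _+_ ∑δ≡1 (∑<-count≡length K α pos bounded) ⟩
    suc (length α) ∎
    where
    ∑δ≡1 : ∑< K (λ j → δ (suc j) (suc a)) ≡ 1
    ∑δ≡1 = trans (∑<-single _ a<K (λ j≢a → δ-≢ (j≢a ∘ suc-injective))) (δ-refl (suc a))

  ∏<-^count≡product : ∀ K α → All (1 ≤_) α → All (_≤ K) α →
                      ∏< K (λ j → suc j ^ count (suc j) α) ≡ prodℕ α
  ∏<-^count≡product K []          _         _               = ∏<-1 K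
  ∏<-^count≡product K (suc a ∷ α) (_ ∷ pos) (a<K ∷ bounded) = begin
    ∏< K (λ j → suc j ^ count (suc j) (suc a ∷ α))
      ≡⟨ ∏<-cong K (λ {j} _ → cong (suc j ^_) (count-∷ (suc j) (suc a) α)) ⟩
    ∏< K (λ j → suc j ^ (δ (suc j) (suc a) + count (suc j) α))
      ≡⟨ ∏<-cong K (λ {j} _ → ^-distribˡ-+-* (suc j) (δ (suc j) (suc a)) (count (suc j) α)) ⟩
    ∏< K (λ j → suc j ^ δ (suc j) (suc a) * suc j ^ count (suc j) α)
      ≡⟨ ∏<-distrib-* K _ _ ⟩
    ∏< K (λ j → suc j ^ δ (suc j) (suc a)) * ∏< K (λ j → suc j ^ count (suc j) α)
      ≡⟨ cong₂ _*_ ∏^δ≡1+a (∏<-^count≡product K α pos bounded) ⟩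
    suc a * prodℕ α ∎
    where
    ∏^δ≡1+a : ∏< K (λ j → suc j ^ δ (suc j) (suc a)) ≡ suc a
    ∏^δ≡1+a = begin
      ∏< K (λ j → suc j ^ δ (suc j) (suc a))
        ≡⟨ ∏<-single _ a<K (λ j≢a → cong (_ ^_) (δ-≢ (j≢a ∘ suc-injective))) ⟩
      suc a ^ δ (suc a) (suc a)              ≡⟨ cong (suc a ^_) (δ-refl (suc a)) ⟩
      suc a ^ 1                              ≡⟨ ^-identityʳ (suc a) ⟩
      suc a ∎

  z-*-multinomial : ∀ α → All (1 ≤_) α → z α * multinomial (mults α) ≡ length α ! * prodℕ α
  z-*-multinomial α pos = begin
    z α * μ              ≡⟨ cong (_* μ) (∏<-distrib-* K (λ j → suc j ^ m j) (λ j → m j !)) ⟩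
    ∏^m * ∏!m * μ        ≡⟨ *-assoc ∏^m ∏!m μ ⟩
    ∏^m * (∏!m * μ)      ≡⟨ cong₂ _*_ (∏<-^count≡product K α pos (All-≤-maxℕ α)) ∏!m*μ≡ℓ! ⟩
    prodℕ α * length α ! ≡⟨ *-comm (prodℕ α) (length α !) ⟩
    length α ! * prodℕ α ∎
    where
    m : ℕ → ℕ
    m j = count (suc j) α
    K μ ∏^m ∏!m : ℕ
    K = maxℕ α
    μ = multinomial (mults α)
    ∏^m = ∏< K (λ j → suc j ^ m j)
    ∏!m = ∏< K (λ j → m j !)
    ∏!m*μ≡ℓ! : ∏!m * μ ≡ length α !
    ∏!m*μ≡ℓ! = begin
      ∏!m * μ                      ≡⟨ cong (λ ns → prodℕ ns * μ) (map-applyUpTo m _! K) ⟨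
      prodℕ (map _! (mults α)) * μ ≡⟨ ∏!-*-multinomial (mults α) ⟩
      sumℕ (mults α) !             ≡⟨ cong _! (∑<-count≡length K α pos (All-≤-maxℕ α)) ⟩
      length α ! ∎

open MultinomialIdentities using (z-*-multinomial; spRel-*-#OSP)
open import Data.Integer as ℤ using (+_)
import Data.Integer.Properties as ℤₚ
open import Data.List.Properties using (map-cong-local)
open import Data.List.Relation.Unary.All.Properties using (concat⁺; map⁺)
open import Data.Nat as ℕ using (_≤_; _!; NonZero)
import Data.Nat.Properties as ℕₚ
open import Data.Nat.ListAction.Properties using (product≢0)
open import Data.Rational using (ℚ; _+_; _*_; fromℚᵘ; toℚᵘ)
open import Data.Rational.Properties
  using (*-assoc; *-distribˡ-+; *-zeroʳ; toℚᵘ-injective; toℚᵘ-homo-*; toℚᵘ-fromℚᵘ; fromℚᵘ-cong)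
open import Data.Rational.Unnormalised as ℚᵘ using (ℚᵘ; mkℚᵘ; *≡*)
import Data.Rational.Unnormalised.Properties as ℚᵘₚ
open ≡-Reasoning

fromℚᵘ-homo-* : ∀ p q → fromℚᵘ (p ℚᵘ.* q) ≡ fromℚᵘ p * fromℚᵘ q
fromℚᵘ-homo-* p q = toℚᵘ-injective (ℚᵘₚ.≃-trans (toℚᵘ-fromℚᵘ (p ℚᵘ.* q)) (ℚᵘₚ.≃-sym homo))
  where
  homo : toℚᵘ (fromℚᵘ p * fromℚᵘ q) ℚᵘ.≃ p ℚᵘ.* q
  homo = ℚᵘₚ.≃-trans (toℚᵘ-homo-* (fromℚᵘ p) (fromℚᵘ q)) (ℚᵘₚ.*-cong (toℚᵘ-fromℚᵘ p) (toℚᵘ-fromℚᵘ q))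

-- ℕtoℚ a and inv (suc c) are the normalisations of a/1 and 1/(1+c); in ℚᵘ, where products are not
-- normalised, the claim is just the cross-multiplication a·b = c·d.
ℕtoℚ*inv≡inv*ℕtoℚ : ∀ {a b c d} .{{_ : NonZero b}} .{{_ : NonZero c}} →
                    a ℕ.* b ≡ c ℕ.* d → ℕtoℚ a * inv c ≡ inv b * ℕtoℚ d
ℕtoℚ*inv≡inv*ℕtoℚ {a} {suc b} {suc c} {d} ab≡cd = begin
  ℕtoℚ a * inv (suc c) ≡⟨ fromℚᵘ-homo-* (mkℚᵘ (+ a) 0) (mkℚᵘ (+ 1) c) ⟨
  fromℚᵘ a/1*1/c       ≡⟨ fromℚᵘ-cong {a/1*1/c} {1/b*d/1} (*≡* cross) ⟩
  fromℚᵘ 1/b*d/1       ≡⟨ fromℚᵘ-homo-* (mkℚᵘ (+ 1) b) (mkℚᵘ (+ d) 0) ⟩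
  inv (suc b) * ℕtoℚ d ∎
  where
  a/1*1/c 1/b*d/1 : ℚᵘ
  a/1*1/c = mkℚᵘ (+ a) 0 ℚᵘ.* mkℚᵘ (+ 1) c
  1/b*d/1 = mkℚᵘ (+ 1) b ℚᵘ.* mkℚᵘ (+ d) 0
  cross : (+ a ℤ.* + 1) ℤ.* + (suc b ℕ.* 1) ≡ (+ 1 ℤ.* + d) ℤ.* + (1 ℕ.* suc c)
  cross = begin
    (+ a ℤ.* + 1) ℤ.* + (suc b ℕ.* 1)
      ≡⟨ cong₂ ℤ._*_ (ℤₚ.*-identityʳ (+ a)) (cong +_ (ℕₚ.*-identityʳ (suc b))) ⟩
    + a ℤ.* + suc b
      ≡⟨ ℤₚ.pos-* a (suc b) ⟨
    + (a ℕ.* suc b)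
      ≡⟨ cong +_ (trans ab≡cd (ℕₚ.*-comm (suc c) d)) ⟩
    + (d ℕ.* suc c)
      ≡⟨ ℤₚ.pos-* d (suc c) ⟩
    + d ℤ.* + suc c
      ≡⟨ cong₂ ℤ._*_ (ℤₚ.*-identityˡ (+ d)) (cong +_ (ℕₚ.*-identityˡ (suc c))) ⟨
    (+ 1 ℤ.* + d) ℤ.* + (1 ℕ.* suc c) ∎

*-distribˡ-sumℚ : ∀ {a} {A : Set a} (c : ℚ) (f : A → ℚ) xs →
                  c * sumℚ (map f xs) ≡ sumℚ (map (λ x → c * f x) xs)
*-distribˡ-sumℚ c f []       = *-zeroʳ c
*-distribˡ-sumℚ c f (x ∷ xs) = trans (*-distribˡ-+ c (f x) _) (cong (_+_ (c * f x)) (*-distribˡ-sumℚ c f xs))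

concat-splittings : ∀ {A : Set} (xs : List A) → All (λ bl → concat bl ≡ xs) (splittings xs)
concat-splittings []       = refl ∷ []
concat-splittings (a ∷ xs) =
  concat⁺ (map⁺ (All.map (λ {bl} eq → All.map (λ e → trans e (cong (a ∷_) eq)) (extend bl))
                         (concat-splittings xs)))
  where
  extend : ∀ bl → All (λ bl′ → concat bl′ ≡ a ∷ concat bl) (extendSplit a bl)
  extend []       = refl ∷ []
  extend (b ∷ bl) = refl ∷ refl ∷ []

z/spRel≡#OSP/multinomial : ∀ α bl → All (1 ≤_) α → concat bl ≡ α →
                           ℕtoℚ (z α) * inv (spRel bl) ≡ inv (multinomial (mults α)) * ℕtoℚ (length (OSP α bl))
z/spRel≡#OSP/multinomial α bl pos concat≡α =
  ℕtoℚ*inv≡inv*ℕtoℚ {z α} {multinomial (mults α)} {spRel bl} {{μ≢0}} {{spRel≢0}}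
    (trans zμ≡L (sym sp#≡L))
  where
  L≢0 : NonZero (length α ! ℕ.* prodℕ α)
  L≢0 = ℕₚ.m*n≢0 _ _ {{ℕₚ._!≢0 (length α)}} {{product≢0 (All.map ℕ.>-nonZero pos)}}
  zμ≡L : z α ℕ.* multinomial (mults α) ≡ length α ! ℕ.* prodℕ α
  zμ≡L = z-*-multinomial α pos
  sp#≡L : spRel bl ℕ.* length (OSP α bl) ≡ length α ! ℕ.* prodℕ α
  sp#≡L = spRel-*-#OSP α bl concat≡α
  μ≢0 : NonZero (multinomial (mults α))
  μ≢0 = ℕₚ.m*n≢0⇒n≢0 (z α) {{subst NonZero (sym zμ≡L) L≢0}}
  spRel≢0 : NonZero (spRel bl)
  spRel≢0 = ℕₚ.m*n≢0⇒m≢0 (spRel bl) {{subst NonZero (sym sp#≡L) L≢0}}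

theorem3p21 : (α : List ℕ) → All (λ p → 1 ≤ p) α → (x : List ℚ) →
    Φ α x ≡
      inv (multinomial (mults α)) *
        sumℚ (map (λ bl → ℕtoℚ (length (OSP α bl)) * M (coarse bl) x) (splittings α))
theorem3p21 α pos x = begin
  ℕtoℚ (z α) * sumℚ (map (λ bl → inv (spRel bl) * M (coarse bl) x) (splittings α))
    ≡⟨ *-distribˡ-sumℚ (ℕtoℚ (z α)) _ (splittings α) ⟩
  sumℚ (map (λ bl → ℕtoℚ (z α) * (inv (spRel bl) * M (coarse bl) x)) (splittings α))
    ≡⟨ cong sumℚ (map-cong-local (All.map term (concat-splittings α))) ⟩
  sumℚ (map (λ bl → inv μ * (ℕtoℚ (length (OSP α bl)) * M (coarse bl) x)) (splittings α))
    ≡⟨ *-distribˡ-sumℚ (inv μ) _ (splittings α) ⟨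
  inv μ * sumℚ (map (λ bl → ℕtoℚ (length (OSP α bl)) * M (coarse bl) x) (splittings α)) ∎
  where
  μ : ℕ
  μ = multinomial (mults α)
  term : ∀ {bl} → concat bl ≡ α →
         ℕtoℚ (z α) * (inv (spRel bl) * M (coarse bl) x) ≡
         inv μ * (ℕtoℚ (length (OSP α bl)) * M (coarse bl) x)
  term {bl} concat≡α = begin
    ℕtoℚ (z α) * (inv (spRel bl) * M (coarse bl) x)
      ≡⟨ *-assoc (ℕtoℚ (z α)) (inv (spRel bl)) _ ⟨
    ℕtoℚ (z α) * inv (spRel bl) * M (coarse bl) x
      ≡⟨ cong (_* M (coarse bl) x) (z/spRel≡#OSP/multinomial α bl pos concat≡α) ⟩
    inv μ * ℕtoℚ (length (OSP α bl)) * M (coarse bl) x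
      ≡⟨ *-assoc (inv μ) (ℕtoℚ (length (OSP α bl))) _ ⟩
    inv μ * (ℕtoℚ (length (OSP α bl)) * M (coarse bl) x) ∎
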